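{- There exist $\varepsilon>0$ and $N_0$ such that the following holds for all $n\ge N_0$. Suppose that $G$ is an $n$-vertex triangle-free graph with $\delta_{C_5}(G)\ge(10-\varepsilon)(n/5)^4$, and there exists a vertex $v\in V(G)$ such that $G-v$ is $C_5$-colorable. Then $G$ is $C_5$-colorable.
   Context: $d_{C_5,G}(v)$ is the number of injective homomorphisms (injective edge-preserving maps) $\phi$ from the 5-cycle $C_5$ to $G$ with $v\in\phi(V(C_5))$; $\delta_{C_5}(G)$ is its minimum over all vertices. A graph is $C_5$-colorable if it admits a homomorphism (edge-preserving map) to $C_5$. $G-v$ is $G$ with $v$ and its incident edges removed. -}

module Defs where

open import Data.Nat using (ℕ; zero; suc; pred)
open import Data.Fin using (Fin; zero; suc; punchIn; _≟_)
open import Data.Bool using (Bool; true; false; _∧_; _∨_; not; if_then_else_)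
open import Data.List using (List; map; allFin)
open import Data.Nat.ListAction using (sum)
open import Data.Product using (Σ; ∃; _×_; _,_)
open import Data.Empty using (⊥)
open import Relation.Nullary.Decidable using (⌊_⌋)
open import Relation.Binary.PropositionalEquality using (_≡_)

record Graph (n : ℕ) : Set where
  field
    adj   : Fin n → Fin n → Bool
    sym   : ∀ a b → adj a b ≡ adj b a
    loopless : ∀ a → adj a a ≡ false
open Graph public

TriangleFree : {n : ℕ} → Graph n → Set
TriangleFree G = ∀ a b c → adj G a b ≡ true → adj G b c ≡ true → adj G a c ≡ true → ⊥

c5adj : Fin 5 → Fin 5 → Bool
c5adj zero (suc zero) = true
c5adj (suc zero) (suc (suc zero)) = true
c5adj (suc (suc zero)) (suc (suc (suc zero))) = true
c5adj (suc (suc (suc zero))) (suc (suc (suc (suc zero)))) = true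
c5adj (suc (suc (suc (suc zero)))) zero = true
c5adj (suc zero) zero = true
c5adj (suc (suc zero)) (suc zero) = true
c5adj (suc (suc (suc zero))) (suc (suc zero)) = true
c5adj (suc (suc (suc (suc zero)))) (suc (suc (suc zero))) = true
c5adj zero (suc (suc (suc (suc zero)))) = true
c5adj _ _ = false

C5Colorable : {n : ℕ} → Graph n → Set
C5Colorable {n} G = Σ (Fin n → Fin 5) λ f → ∀ a b → adj G a b ≡ true → c5adj (f a) (f b) ≡ true

deleteVertex : {n : ℕ} → Graph n → Fin n → Graph (pred n)
deleteVertex {suc m} G v = record
  { adj = λ a b → adj G (punchIn v a) (punchIn v b)
  ; sym = λ a b → sym G (punchIn v a) (punchIn v b)
  ; loopless = λ a → loopless G (punchIn v a) }

private
  eqb : {n : ℕ} → Fin n → Fin n → Bool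
  eqb a b = ⌊ a ≟ b ⌋

  neq : {n : ℕ} → Fin n → Fin n → Bool
  neq a b = not (eqb a b)

goodC5 : {n : ℕ} → Graph n → Fin n → Fin n → Fin n → Fin n → Fin n → Fin n → Bool
goodC5 G v x0 x1 x2 x3 x4 =
  (adj G x0 x1 ∧ adj G x1 x2 ∧ adj G x2 x3 ∧ adj G x3 x4 ∧ adj G x4 x0)
  ∧ (neq x0 x1 ∧ neq x0 x2 ∧ neq x0 x3 ∧ neq x0 x4 ∧ neq x1 x2
     ∧ neq x1 x3 ∧ neq x1 x4 ∧ neq x2 x3 ∧ neq x2 x4 ∧ neq x3 x4)
  ∧ (eqb v x0 ∨ eqb v x1 ∨ eqb v x2 ∨ eqb v x3 ∨ eqb v x4)

dC5 : {n : ℕ} → Graph n → Fin n → ℕ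
dC5 {n} G v =
  sum (map (λ x0 → sum (map (λ x1 → sum (map (λ x2 → sum (map (λ x3 → sum (map (λ x4 →
    if goodC5 G v x0 x1 x2 x3 x4 then 1 else 0)
    (allFin n))) (allFin n))) (allFin n))) (allFin n))) (allFin n))

-- Fix a C₅-colouring of G − v with colour classes X₀, …, X₄.  A 5-cycle through
-- w ≠ v that avoids v is coloured by a closed 5-walk of C₅, which must go once around
-- C₅; hence w lies in at most 10·|N(w) ∩ X_{c+1}|·|X_{c+2}|·|X_{c-2}|·|X_{c-1}| + O(n³)
-- five-cycles, where c is the colour of w.  As every vertex lies in almost 10(n/5)⁴
-- five-cycles, AM–GM forces every class to have at most about n/5 vertices, and then
-- every w ≠ v is adjacent to all but o(n) vertices of the class after its own (and, by
-- reflecting C₅, of the class before it).  If no colour can be given to v, then every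
-- colour is non-adjacent in C₅ to the colour of some neighbour of v, and among any such
-- choice of five colours two are adjacent: v has neighbours x, y with adjacent colours.
-- In a 5-cycle v y₁ y₂ y₃ y₄, one of y₁, y₄ must then have a colour adjacent to that of
-- x or y; being a common neighbour with v it is, by triangle-freeness, one of the o(n)
-- non-neighbours of x or y in the neighbouring classes.  So v lies in only o(n⁴)
-- five-cycles, a contradiction.

module Submission where

-- A separate module keeps ℕ's operators apart from the rational ones of the statement.
module C5Extension where

  open import Defs hiding (sym)
  open import Data.Bool using (true; false; not; if_then_else_)
  open import Data.Bool.Properties using (T-≡)
  open import Data.Empty using (⊥)
  open import Data.Fin using (Fin; zero; suc; _≟_; punchOut)
  open import Data.Fin.Patterns using (0F; 1F; 2F; 3F; 4F)
  open import Data.Fin.Properties using (all?; any?; ¬∀⟶∃¬; punchIn-punchOut; punchOut-cong)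
  open import Data.List using ([]; _∷_)
  import Data.List as List using (map; allFin; tabulate)
  import Data.List.Properties as List using (map-tabulate)
  import Data.Nat.ListAction as ListAction using (sum)
  open import Data.Nat hiding (_≟_)
  open import Data.Nat.Properties hiding (_≟_)
  open import Algebra.Properties.Semiring.Sum +-*-semiring
    using (sum; sum-syntax; ∑-distrib-+; ∑-comm; sum-cong-≗; *-distribˡ-sum; *-distribʳ-sum)
  open import Data.Nat.Tactic.RingSolver using (solve; solve-∀)
  open import Data.Product using (Σ; ∃; ∃₂; _×_; _,_; proj₁; proj₂)
  open import Data.Sum using (_⊎_; inj₁; inj₂; [_,_]′)
  import Data.Sum as Sum
  import Data.Vec as Vec using (lookup; []; _∷_)
  import Data.Vec.Properties as Vec using (lookup∘tabulate)
  open import Data.Vec.Functional using (Vector)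
  open import Function using (_∘_)
  open import Function.Bundles using (Equivalence)
  open import Level using (0ℓ)
  open import Relation.Binary.PropositionalEquality
  open import Relation.Nullary
  open import Relation.Nullary.Decidable using (⌊_⌋; from-yes; decidable-stable; toWitness; toWitnessFalse)
  open import Relation.Nullary.Reflects using (Reflects)
  open import Relation.Unary using (Pred; Decidable)

  private
    variable
      n : ℕ
      P Q R : Pred (Fin n) 0ℓ

  -- Finite sums and counting

  ∑-mono-≤ : ∀ {n} {f g : Vector ℕ n} → (∀ i → f i ≤ g i) → sum f ≤ sum g
  ∑-mono-≤ {zero}  f≤g = z≤n
  ∑-mono-≤ {suc n} f≤g = +-mono-≤ (f≤g zero) (∑-mono-≤ (f≤g ∘ suc))

  ∑-const : ∀ n x → ∑[ i < n ] x ≡ n * x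
  ∑-const zero    x = refl
  ∑-const (suc n) x = cong (x +_) (∑-const n x)

  ∑-one : ∀ n → ∑[ i < n ] 1 ≡ n
  ∑-one n = trans (∑-const n 1) (*-identityʳ n)

  ∑-*ˡ : ∀ {n} x (f : Vector ℕ n) → ∑[ i < n ] (x * f i) ≡ x * sum f
  ∑-*ˡ x f = sym (*-distribˡ-sum x f)

  ∑-*ʳ : ∀ {n} x (f : Vector ℕ n) → ∑[ i < n ] (f i * x) ≡ sum f * x
  ∑-*ʳ x f = sym (*-distribʳ-sum x f)

  ∑-positive : ∀ {n} (f : Vector ℕ n) → 0 < sum f → ∃ λ i → 0 < f i
  ∑-positive {suc n} f 0<∑ with f zero in eq
  ... | suc _ = zero , subst (0 <_) (sym eq) z<s
  ... | zero  = let i , 0<fi = ∑-positive (f ∘ suc) 0<∑ in suc i , 0<fi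

  +-positive : ∀ {a b} → 0 < a ⊎ 0 < b → 0 < a + b
  +-positive = [ m≤n⇒m≤n+o _ , m≤n⇒m≤o+n _ ]′

  *-positive⁴ : ∀ {a b c d} → 0 < a → 0 < b → 0 < c → 0 < d → 0 < a * b * c * d
  *-positive⁴ 0<a 0<b 0<c 0<d = *-mono-≤ (*-mono-≤ (*-mono-≤ 0<a 0<b) 0<c) 0<d

  -- Through does rather than by matching on yes/no, so that 𝟙 applied to a decision
  -- whose does is a Boolean b computes to if b then 1 else 0, as in dC5.
  𝟙 : ∀ {A : Set} → Dec A → ℕ
  𝟙 A? = if does A? then 1 else 0

  𝟙-positive : ∀ {A : Set} (A? : Dec A) → A → 0 < 𝟙 A?
  𝟙-positive (yes _) _ = ≤-refl
  𝟙-positive (no ¬a) a = contradiction a ¬a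

  𝟙-positive⁻¹ : ∀ {A : Set} (A? : Dec A) → 0 < 𝟙 A? → A
  𝟙-positive⁻¹ (yes a) _ = a

  𝟙-≤ : ∀ {A : Set} {x} (A? : Dec A) → (A → 0 < x) → 𝟙 A? ≤ x
  𝟙-≤ (yes a) 0<x = 0<x a
  𝟙-≤ (no _)  _   = z≤n

  count : ∀ {n} {P : Pred (Fin n) 0ℓ} → Decidable P → ℕ
  count {n} P? = ∑[ i < n ] 𝟙 (P? i)

  count≤n : ∀ {n} {P : Pred (Fin n) 0ℓ} (P? : Decidable P) → count P? ≤ n
  count≤n {n} P? = ≤-trans (∑-mono-≤ λ i → 𝟙-≤ (P? i) λ _ → ≤-refl) (≤-reflexive (∑-one n))

  count-≟ : ∀ {n} (u : Fin n) → count (_≟ u) ≡ 1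
  count-≟ {suc n} zero    = cong suc (trans (∑-const n 0) (*-zeroʳ n))
  count-≟ {suc n} (suc u) = count-≟ u

  count-positive : (P? : Decidable P) → 0 < count P? → ∃ P
  count-positive P? 0<count = let i , 0<𝟙 = ∑-positive (𝟙 ∘ P?) 0<count in i , 𝟙-positive⁻¹ (P? i) 0<𝟙

  count-⊆-∪ : (P? : Decidable P) (Q? : Decidable Q) (R? : Decidable R) → (∀ {i} → P i → Q i ⊎ R i) →
              count P? ≤ count Q? + count R?
  count-⊆-∪ P? Q? R? P⊆Q∪R = ≤-trans
    (∑-mono-≤ λ i → 𝟙-≤ (P? i) (+-positive ∘ Sum.map (𝟙-positive (Q? i)) (𝟙-positive (R? i)) ∘ P⊆Q∪R))
    (≤-reflexive (∑-distrib-+ (𝟙 ∘ Q?) (𝟙 ∘ R?)))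

  count-split : (P? : Decidable P) (Q? : Decidable Q) →
                count (λ i → Q? i ×-dec P? i) + count (λ i → ¬? (Q? i) ×-dec P? i) ≡ count P?
  count-split P? Q? = trans (sym (∑-distrib-+ (λ i → 𝟙 (Q? i ×-dec P? i)) (λ i → 𝟙 (¬? (Q? i) ×-dec P? i))))
                            (sum-cong-≗ λ i → 𝟙-split (Q? i) (P? i))
    where
    𝟙-split : ∀ {A B : Set} (A? : Dec A) (B? : Dec B) → 𝟙 (A? ×-dec B?) + 𝟙 (¬? A? ×-dec B?) ≡ 𝟙 B?
    𝟙-split (yes _) (yes _) = refl
    𝟙-split (yes _) (no _)  = refl
    𝟙-split (no _)  (yes _) = refl
    𝟙-split (no _)  (no _)  = refl

  ∑² : (Fin n → Fin n → ℕ) → ℕ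
  ∑² {n} Φ = ∑[ a < n ] sum (Φ a)

  ∑³ : (Fin n → Fin n → Fin n → ℕ) → ℕ
  ∑³ {n} Φ = ∑[ a < n ] ∑² (Φ a)

  ∑⁴ : (Fin n → Fin n → Fin n → Fin n → ℕ) → ℕ
  ∑⁴ {n} Φ = ∑[ a < n ] ∑³ (Φ a)

  ∑⁵ : (Fin n → Fin n → Fin n → Fin n → Fin n → ℕ) → ℕ
  ∑⁵ {n} Φ = ∑[ a < n ] ∑⁴ (Φ a)

  ∑²-+ : (Φ Ψ : Fin n → Fin n → ℕ) → ∑² (λ a b → Φ a b + Ψ a b) ≡ ∑² Φ + ∑² Ψ
  ∑²-+ Φ Ψ = trans (sum-cong-≗ λ a → ∑-distrib-+ (Φ a) (Ψ a)) (∑-distrib-+ (sum ∘ Φ) (sum ∘ Ψ))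

  ∑³-+ : (Φ Ψ : Fin n → Fin n → Fin n → ℕ) → ∑³ (λ a b c → Φ a b c + Ψ a b c) ≡ ∑³ Φ + ∑³ Ψ
  ∑³-+ Φ Ψ = trans (sum-cong-≗ λ a → ∑²-+ (Φ a) (Ψ a)) (∑-distrib-+ (∑² ∘ Φ) (∑² ∘ Ψ))

  ∑⁴-+ : (Φ Ψ : Fin n → Fin n → Fin n → Fin n → ℕ) →
         ∑⁴ (λ a b c d → Φ a b c d + Ψ a b c d) ≡ ∑⁴ Φ + ∑⁴ Ψ
  ∑⁴-+ Φ Ψ = trans (sum-cong-≗ λ a → ∑³-+ (Φ a) (Ψ a)) (∑-distrib-+ (∑³ ∘ Φ) (∑³ ∘ Ψ))

  ∑⁵-+ : (Φ Ψ : Fin n → Fin n → Fin n → Fin n → Fin n → ℕ) →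
         ∑⁵ (λ a b c d e → Φ a b c d e + Ψ a b c d e) ≡ ∑⁵ Φ + ∑⁵ Ψ
  ∑⁵-+ Φ Ψ = trans (sum-cong-≗ λ a → ∑⁴-+ (Φ a) (Ψ a)) (∑-distrib-+ (∑⁴ ∘ Φ) (∑⁴ ∘ Ψ))

  ∑²-*ˡ : ∀ x (Φ : Fin n → Fin n → ℕ) → ∑² (λ a b → x * Φ a b) ≡ x * ∑² Φ
  ∑²-*ˡ x Φ = trans (sum-cong-≗ λ a → ∑-*ˡ x (Φ a)) (∑-*ˡ x (sum ∘ Φ))

  ∑³-*ˡ : ∀ x (Φ : Fin n → Fin n → Fin n → ℕ) → ∑³ (λ a b c → x * Φ a b c) ≡ x * ∑³ Φ
  ∑³-*ˡ x Φ = trans (sum-cong-≗ λ a → ∑²-*ˡ x (Φ a)) (∑-*ˡ x (∑² ∘ Φ))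

  ∑⁴-*ˡ : ∀ x (Φ : Fin n → Fin n → Fin n → Fin n → ℕ) → ∑⁴ (λ a b c d → x * Φ a b c d) ≡ x * ∑⁴ Φ
  ∑⁴-*ˡ x Φ = trans (sum-cong-≗ λ a → ∑³-*ˡ x (Φ a)) (∑-*ˡ x (∑³ ∘ Φ))

  rotate⁵ : (Fin n → Fin n → Fin n → Fin n → Fin n → ℕ) → Fin n → Fin n → Fin n → Fin n → Fin n → ℕ
  rotate⁵ Φ a b c d e = Φ b c d e a

  ∑⁵-rotate : (Φ : Fin n → Fin n → Fin n → Fin n → Fin n → ℕ) → ∑⁵ (rotate⁵ Φ) ≡ ∑⁵ Φ
  ∑⁵-rotate {n} Φ = begin
    ∑[ a < n ] ∑[ b < n ] ∑[ c < n ] ∑[ d < n ] ∑[ e < n ] Φ b c d e a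
      ≡⟨ ∑-comm (λ a b → ∑[ c < n ] ∑[ d < n ] ∑[ e < n ] Φ b c d e a) ⟩
    ∑[ b < n ] ∑[ a < n ] ∑[ c < n ] ∑[ d < n ] ∑[ e < n ] Φ b c d e a
      ≡⟨ sum-cong-≗ (λ b → ∑-comm λ a c → ∑[ d < n ] ∑[ e < n ] Φ b c d e a) ⟩
    ∑[ b < n ] ∑[ c < n ] ∑[ a < n ] ∑[ d < n ] ∑[ e < n ] Φ b c d e a
      ≡⟨ sum-cong-≗ (λ b → sum-cong-≗ λ c → ∑-comm λ a d → ∑[ e < n ] Φ b c d e a) ⟩
    ∑[ b < n ] ∑[ c < n ] ∑[ d < n ] ∑[ a < n ] ∑[ e < n ] Φ b c d e a
      ≡⟨ sum-cong-≗ (λ b → sum-cong-≗ λ c → sum-cong-≗ λ d → ∑-comm λ a e → Φ b c d e a) ⟩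
    ∑[ b < n ] ∑[ c < n ] ∑[ d < n ] ∑[ e < n ] ∑[ a < n ] Φ b c d e a
      ∎
    where open ≡-Reasoning

  infixr 6 _⊕_

  _⊕_ : (Φ Ψ : Fin n → Fin n → Fin n → Fin n → ℕ) → Fin n → Fin n → Fin n → Fin n → ℕ
  (Φ ⊕ Ψ) a b c d = Φ a b c d + Ψ a b c d

  _⊗_⊗_⊗_ : (f g h k : Fin n → ℕ) → Fin n → Fin n → Fin n → Fin n → ℕ
  (f ⊗ g ⊗ h ⊗ k) a b c d = f a * g b * h c * k d

  ∑⁴-⊗ : (f g h k : Fin n → ℕ) → ∑⁴ (f ⊗ g ⊗ h ⊗ k) ≡ sum f * sum g * sum h * sum k
  ∑⁴-⊗ {n} f g h k = begin
    ∑[ a < n ] ∑[ b < n ] ∑[ c < n ] ∑[ d < n ] (f a * g b * h c * k d)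
      ≡⟨ sum-cong-≗ (λ a → sum-cong-≗ λ b → sum-cong-≗ λ c → ∑-*ˡ (f a * g b * h c) k) ⟩
    ∑[ a < n ] ∑[ b < n ] ∑[ c < n ] (f a * g b * h c * sum k)
      ≡⟨ sum-cong-≗ (λ a → sum-cong-≗ λ b →
           trans (∑-*ʳ (sum k) (λ c → f a * g b * h c)) (cong (_* sum k) (∑-*ˡ (f a * g b) h))) ⟩
    ∑[ a < n ] ∑[ b < n ] (f a * g b * sum h * sum k)
      ≡⟨ sum-cong-≗ (λ a → trans (∑-*ʳ (sum k) (λ b → f a * g b * sum h))
           (cong (_* sum k) (trans (∑-*ʳ (sum h) (λ b → f a * g b)) (cong (_* sum h) (∑-*ˡ (f a) g))))) ⟩
    ∑[ a < n ] (f a * sum g * sum h * sum k)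
      ≡⟨ trans (∑-*ʳ (sum k) (λ a → f a * sum g * sum h))
           (cong (_* sum k) (trans (∑-*ʳ (sum h) (λ a → f a * sum g)) (cong (_* sum h) (∑-*ʳ (sum g) f)))) ⟩
    sum f * sum g * sum h * sum k
      ∎
    where open ≡-Reasoning

  ∑-allFin : ∀ {n} {f g : Fin n → ℕ} → (∀ i → f i ≡ g i) → ListAction.sum (List.map f (List.allFin n)) ≡ sum g
  ∑-allFin {f = f} f≗g = trans (cong ListAction.sum (List.map-tabulate (λ i → i) f)) (sum-tabulate f≗g)
    where
    sum-tabulate : ∀ {n} {f g : Fin n → ℕ} → (∀ i → f i ≡ g i) → ListAction.sum (List.tabulate f) ≡ sum g
    sum-tabulate {zero}  f≗g = refl
    sum-tabulate {suc n} f≗g = cong₂ _+_ (f≗g zero) (sum-tabulate (f≗g ∘ suc))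

  -- Inequalities between natural numbers

  absorb-cubic : ∀ {M L D P n} → suc M * (n * n * n * n) ≤ L * D → D ≤ 10 * P + 20 * (n * n * n) → 20 * L ≤ n →
                 M * (n * n * n * n) ≤ 10 * L * P
  absorb-cubic {M} {L} {D} {P} {n} dense D≤ 20L≤n = +-cancelˡ-≤ (n * n * n * n) _ _ (begin
    n * n * n * n + M * (n * n * n * n) ≡⟨⟩
    suc M * (n * n * n * n)             ≤⟨ dense ⟩
    L * D                               ≤⟨ *-monoʳ-≤ L D≤ ⟩
    L * (10 * P + 20 * (n * n * n))     ≡⟨ solve (L ∷ P ∷ n ∷ []) ⟩
    20 * L * (n * n * n) + 10 * L * P   ≤⟨ +-monoˡ-≤ (10 * L * P) (*-monoˡ-≤ (n * n * n) 20L≤n) ⟩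
    n * (n * n * n) + 10 * L * P        ≡⟨ solve (L ∷ P ∷ n ∷ []) ⟩
    n * n * n * n + 10 * L * P          ∎)
    where open ≤-Reasoning

  am-gm² : ∀ a b → 4 * (a * b) ≤ (a + b) * (a + b)
  am-gm² a b = [ ordered , swapped ]′ (≤-total a b)
    where
    ordered : ∀ {a b} → a ≤ b → 4 * (a * b) ≤ (a + b) * (a + b)
    ordered {a} a≤b with m≤n⇒∃[o]m+o≡n a≤b
    ... | k , refl = begin
      4 * (a * (a + k))                ≤⟨ m≤m+n _ (k * k) ⟩
      4 * (a * (a + k)) + k * k        ≡⟨ solve (a ∷ k ∷ []) ⟩
      (a + (a + k)) * (a + (a + k))    ∎
      where open ≤-Reasoning
    swapped : b ≤ a → 4 * (a * b) ≤ (a + b) * (a + b)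
    swapped b≤a = subst₂ _≤_ (cong (4 *_) (*-comm b a)) (cong₂ _*_ (+-comm b a) (+-comm b a)) (ordered b≤a)

  am-gm⁴ : ∀ a b c d → 256 * (a * b * c * d) ≤ (a + b + c + d) * (a + b + c + d) * (a + b + c + d) * (a + b + c + d)
  am-gm⁴ a b c d = begin
    256 * (a * b * c * d)                                 ≡⟨ solve (a ∷ b ∷ c ∷ d ∷ []) ⟩
    16 * ((4 * (a * b)) * (4 * (c * d)))                  ≤⟨ *-monoʳ-≤ 16 (*-mono-≤ (am-gm² a b) (am-gm² c d)) ⟩
    16 * (((a + b) * (a + b)) * ((c + d) * (c + d)))      ≡⟨ solve (a ∷ b ∷ c ∷ d ∷ []) ⟩
    (4 * ((a + b) * (c + d))) * (4 * ((a + b) * (c + d))) ≤⟨ *-mono-≤ (am-gm² (a + b) (c + d)) (am-gm² (a + b) (c + d)) ⟩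
    ((a + b + (c + d)) * (a + b + (c + d))) * ((a + b + (c + d)) * (a + b + (c + d)))
                                                          ≡⟨ solve (a ∷ b ∷ c ∷ d ∷ []) ⟩
    (a + b + c + d) * (a + b + c + d) * (a + b + c + d) * (a + b + c + d) ∎
    where open ≤-Reasoning

  ⁴-mono-< : ∀ {x y} → x < y → x * x * x * x < y * y * y * y
  ⁴-mono-< x<y = *-mono-< (*-mono-< (*-mono-< x<y x<y) x<y) x<y

  ⁴-ratio-≤ : ∀ {B C p q n s} .{{_ : NonZero B}} →
              B * (p * p * p * p) ≤ C * (q * q * q * q) → C * (n * n * n * n) ≤ B * (s * s * s * s) → p * n ≤ s * q
  ⁴-ratio-≤ {B} {C} {p} {q} {n} {s} Bp⁴≤Cq⁴ Cn⁴≤Bs⁴ = ≮⇒≥ λ sq<pn → <-irrefl refl (begin-strict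
    B * ((s * q) * (s * q) * (s * q) * (s * q)) <⟨ *-monoʳ-< B (⁴-mono-< sq<pn) ⟩
    B * ((p * n) * (p * n) * (p * n) * (p * n)) ≡⟨ solve (B ∷ p ∷ n ∷ []) ⟩
    B * (p * p * p * p) * (n * n * n * n)       ≤⟨ *-monoˡ-≤ (n * n * n * n) Bp⁴≤Cq⁴ ⟩
    C * (q * q * q * q) * (n * n * n * n)       ≡⟨ solve (C ∷ q ∷ n ∷ []) ⟩
    (q * q * q * q) * (C * (n * n * n * n))     ≤⟨ *-monoʳ-≤ (q * q * q * q) Cn⁴≤Bs⁴ ⟩
    (q * q * q * q) * (B * (s * s * s * s))     ≡⟨ solve (B ∷ q ∷ s ∷ []) ⟩
    B * ((s * q) * (s * q) * (s * q) * (s * q)) ∎)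
    where open ≤-Reasoning

  complement-≤ : ∀ {A s n p q r} → A + s ≤ n → p * n ≤ s * q → q ≡ r + p → A * q ≤ r * n
  complement-≤ {A} {s} {n} {p} {q} {r} A+s≤n pn≤sq refl = +-cancelʳ-≤ (p * n) (A * q) (r * n) (begin
    A * q + p * n   ≤⟨ +-monoʳ-≤ (A * q) pn≤sq ⟩
    A * q + s * q   ≡⟨ *-distribʳ-+ q A s ⟨
    (A + s) * q     ≤⟨ *-monoˡ-≤ q A+s≤n ⟩
    n * q           ≡⟨ solve (n ∷ r ∷ p ∷ []) ⟩
    r * n + p * n   ∎)
    where open ≤-Reasoning

  -- Adding B t Q to M n⁴ ≤ B N Q and using q⁴ A Q ≤ r⁴ n⁴ bounds q⁴ B t Q by γ n⁴;
  -- on the other hand Q ≥ M n³ / B because N ≤ n.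
  excess-≤ : ∀ {M B N t A Q q r γ n} → 0 < n →
    M * (n * n * n * n) ≤ B * (N * Q) → N + t ≡ A → N ≤ n →
    (q * q * q * q) * (A * Q) ≤ (r * r * r * r) * (n * n * n * n) → B * (r * r * r * r) ≤ γ + M * (q * q * q * q) →
    t * (M * (q * q * q * q)) ≤ γ * n
  excess-≤ {M} {B} {N} {t} {A} {Q} {q} {r} {γ} {n} 0<n Mn⁴≤BNQ N+t≡A N≤n q⁴AQ≤r⁴n⁴ Br⁴≤ =
    *-cancelʳ-≤ (t * (M * (q * q * q * q))) (γ * n) (n * n * n) {{n³≢0}} (begin
      t * (M * (q * q * q * q)) * (n * n * n)  ≡⟨ solve (t ∷ M ∷ q ∷ n ∷ []) ⟩
      t * (q * q * q * q) * (M * (n * n * n))  ≤⟨ *-monoʳ-≤ (t * (q * q * q * q)) Mn³≤BQ ⟩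
      t * (q * q * q * q) * (B * Q)            ≡⟨ solve (t ∷ q ∷ B ∷ Q ∷ []) ⟩
      (q * q * q * q) * (B * t * Q)            ≤⟨ q⁴BtQ≤γn⁴ ⟩
      γ * (n * n * n * n)                      ≡⟨ solve (γ ∷ n ∷ []) ⟩
      γ * n * (n * n * n)                      ∎)
    where
    open ≤-Reasoning
    instance
      n≢0 : NonZero n
      n≢0 = >-nonZero 0<n
    n³≢0 : NonZero (n * n * n)
    n³≢0 = m*n≢0 (n * n) n {{m*n≢0 n n}}

    Mn³≤BQ : M * (n * n * n) ≤ B * Q
    Mn³≤BQ = *-cancelˡ-≤ n (begin
      n * (M * (n * n * n))  ≡⟨ solve (n ∷ M ∷ []) ⟩
      M * (n * n * n * n)    ≤⟨ Mn⁴≤BNQ ⟩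
      B * (N * Q)            ≤⟨ *-monoʳ-≤ B (*-monoˡ-≤ Q N≤n) ⟩
      B * (n * Q)            ≡⟨ solve (B ∷ n ∷ Q ∷ []) ⟩
      n * (B * Q)            ∎)

    q⁴BtQ≤γn⁴ : (q * q * q * q) * (B * t * Q) ≤ γ * (n * n * n * n)
    q⁴BtQ≤γn⁴ = +-cancelʳ-≤ (M * (q * q * q * q) * (n * n * n * n)) _ _ (begin
      (q * q * q * q) * (B * t * Q) + M * (q * q * q * q) * (n * n * n * n)
        ≡⟨ solve (q ∷ B ∷ t ∷ Q ∷ M ∷ n ∷ []) ⟩
      (q * q * q * q) * (B * t * Q) + (q * q * q * q) * (M * (n * n * n * n))
        ≤⟨ +-monoʳ-≤ ((q * q * q * q) * (B * t * Q)) (*-monoʳ-≤ (q * q * q * q) Mn⁴≤BNQ) ⟩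
      (q * q * q * q) * (B * t * Q) + (q * q * q * q) * (B * (N * Q))
        ≡⟨ solve (q ∷ B ∷ t ∷ Q ∷ N ∷ []) ⟩
      B * ((q * q * q * q) * ((N + t) * Q))
        ≡⟨ cong (λ A → B * ((q * q * q * q) * (A * Q))) N+t≡A ⟩
      B * ((q * q * q * q) * (A * Q))
        ≤⟨ *-monoʳ-≤ B q⁴AQ≤r⁴n⁴ ⟩
      B * ((r * r * r * r) * (n * n * n * n))
        ≡⟨ solve (B ∷ r ∷ n ∷ []) ⟩
      B * (r * r * r * r) * (n * n * n * n)
        ≤⟨ *-monoˡ-≤ (n * n * n * n) Br⁴≤ ⟩
      (γ + M * (q * q * q * q)) * (n * n * n * n)
        ≡⟨ solve (γ ∷ M ∷ q ∷ n ∷ []) ⟩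
      γ * (n * n * n * n) + M * (q * q * q * q) * (n * n * n * n)
        ∎)

  dense-contradiction : ∀ {M L D S t₁ t₂ t₃ t₄ K γ n} → 0 < n →
    suc M * (n * n * n * n) ≤ L * D → D ≤ 10 * (S * (n * n * n)) → S ≤ (t₁ + t₂) + (t₃ + t₄) →
    t₁ * K ≤ γ * n → t₂ * K ≤ γ * n → t₃ * K ≤ γ * n → t₄ * K ≤ γ * n → 40 * L * γ < suc M * K → ⊥
  dense-contradiction {M} {L} {D} {S} {t₁} {t₂} {t₃} {t₄} {K} {γ} {n}
                      0<n dense D≤ S≤ t₁K≤ t₂K≤ t₃K≤ t₄K≤ 40Lγ<
    = <⇒≱ (*-monoˡ-< (n * n * n * n) {{n⁴≢0}} 40Lγ<) (begin
      suc M * K * (n * n * n * n)                        ≡⟨ solve (M ∷ K ∷ n ∷ []) ⟩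
      K * (suc M * (n * n * n * n))                      ≤⟨ *-monoʳ-≤ K dense ⟩
      K * (L * D)                                        ≤⟨ *-monoʳ-≤ K (*-monoʳ-≤ L D≤) ⟩
      K * (L * (10 * (S * (n * n * n))))                 ≡⟨ solve (K ∷ L ∷ S ∷ n ∷ []) ⟩
      10 * L * (n * n * n) * (S * K)                     ≤⟨ *-monoʳ-≤ (10 * L * (n * n * n)) (*-monoˡ-≤ K S≤) ⟩
      10 * L * (n * n * n) * ((t₁ + t₂ + (t₃ + t₄)) * K)
        ≡⟨ cong (10 * L * (n * n * n) *_) (solve (t₁ ∷ t₂ ∷ t₃ ∷ t₄ ∷ K ∷ [])) ⟩
      10 * L * (n * n * n) * (t₁ * K + t₂ * K + (t₃ * K + t₄ * K))
        ≤⟨ *-monoʳ-≤ (10 * L * (n * n * n)) (+-mono-≤ (+-mono-≤ t₁K≤ t₂K≤) (+-mono-≤ t₃K≤ t₄K≤)) ⟩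
      10 * L * (n * n * n) * (γ * n + γ * n + (γ * n + γ * n))
        ≡⟨ solve (L ∷ γ ∷ n ∷ []) ⟩
      40 * L * γ * (n * n * n * n)                       ∎)
    where
    open ≤-Reasoning
    instance
      n≢0 : NonZero n
      n≢0 = >-nonZero 0<n
    n⁴≢0 : NonZero (n * n * n * n)
    n⁴≢0 = m*n≢0 (n * n * n) n {{m*n≢0 (n * n) n {{m*n≢0 n n}}}}

  -- The 5-cycle C₅

  true-reflects : ∀ b → Reflects (b ≡ true) b
  true-reflects true  = ofʸ refl
  true-reflects false = ofⁿ λ ()

  -- Unlike Data.Bool.Properties._≟_, this decision reduces to b itself, so
  -- decisions assembled from it compute exactly the Booleans of Defs.
  isTrue? : ∀ b → Dec (b ≡ true)
  isTrue? b = b because true-reflects b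

  infix 4 _~_ _~?_

  _~_ : Fin 5 → Fin 5 → Set
  a ~ b = c5adj a b ≡ true

  _~?_ : ∀ a b → Dec (a ~ b)
  a ~? b = isTrue? (c5adj a b)

  next prev reflect : Fin 5 → Fin 5
  next 0F = 1F
  next 1F = 2F
  next 2F = 3F
  next 3F = 4F
  next 4F = 0F
  prev 0F = 4F
  prev 1F = 0F
  prev 2F = 1F
  prev 3F = 2F
  prev 4F = 3F
  reflect 0F = 0F
  reflect 1F = 4F
  reflect 2F = 3F
  reflect 3F = 2F
  reflect 4F = 1F

  -- Each fact is checked exhaustively; opaque, so that unification never unfolds
  -- the exhaustive check on open terms.
  opaque
    ~-sym : ∀ {a b} → a ~ b → b ~ a
    ~-sym {a} {b} = from-yes (all? λ a → all? λ b → a ~? b →-dec b ~? a) a b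

    ~⇒next⊎prev : ∀ {a b} → a ~ b → b ≡ next a ⊎ b ≡ prev a
    ~⇒next⊎prev {a} {b} = from-yes (all? λ a → all? λ b → a ~? b →-dec (b ≟ next a ⊎-dec b ≟ prev a)) a b

    reflect-hom : ∀ {a b} → a ~ b → reflect a ~ reflect b
    reflect-hom {a} {b} = from-yes (all? λ a → all? λ b → a ~? b →-dec reflect a ~? reflect b) a b

    reflect-prev : ∀ a → reflect (prev a) ≡ next (reflect a)
    reflect-prev = from-yes (all? λ a → reflect (prev a) ≟ next (reflect a))

    closed-5-walk : ∀ {c a b d e} → c ~ a → a ~ b → b ~ d → d ~ e → e ~ c →
      (a ≡ next c × b ≡ next (next c) × d ≡ prev (prev c) × e ≡ prev c) ⊎
      (a ≡ prev c × b ≡ prev (prev c) × d ≡ next (next c) × e ≡ next c)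
    closed-5-walk {c} {a} {b} {d} {e} = from-yes (all? λ c → all? λ a → all? λ b → all? λ d → all? λ e →
      c ~? a →-dec a ~? b →-dec b ~? d →-dec d ~? e →-dec e ~? c →-dec
        ((a ≟ next c ×-dec b ≟ next (next c) ×-dec d ≟ prev (prev c) ×-dec e ≟ prev c) ⊎-dec
         (a ≟ prev c ×-dec b ≟ prev (prev c) ×-dec d ≟ next (next c) ×-dec e ≟ next c))) c a b d e

    no-closed-3-walk : ∀ {a b c d} → a ~ b → b ~ c → c ~ d → a ≢ d
    no-closed-3-walk {a} {b} {c} {d} = from-yes (all? λ a → all? λ b → all? λ c → all? λ d →
      a ~? b →-dec b ~? c →-dec c ~? d →-dec ¬? (a ≟ d)) a b c d

    common-non-neighbour-unique : ∀ {x y a d} → x ~ y → ¬ x ~ a → ¬ y ~ a → ¬ x ~ d → ¬ y ~ d → a ≡ d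
    common-non-neighbour-unique {x} {y} {a} {d} = from-yes (all? λ x → all? λ y → all? λ a → all? λ d →
      x ~? y →-dec ¬? (x ~? a) →-dec ¬? (y ~? a) →-dec ¬? (x ~? d) →-dec ¬? (y ~? d) →-dec a ≟ d) x y a d

    five-colours : ∀ a c →
      𝟙 (a ≟ c) + (𝟙 (a ≟ next c) + 𝟙 (a ≟ next (next c)) + 𝟙 (a ≟ prev (prev c)) + 𝟙 (a ≟ prev c)) ≤ 1
    five-colours = from-yes (all? λ a → all? λ c →
      𝟙 (a ≟ c) + (𝟙 (a ≟ next c) + 𝟙 (a ≟ next (next c)) + 𝟙 (a ≟ prev (prev c)) + 𝟙 (a ≟ prev c)) ≤? 1)

    non-neighbour-choices : ∀ e₀ e₁ e₂ e₃ e₄ →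
      let E = Vec.lookup (e₀ Vec.∷ e₁ Vec.∷ e₂ Vec.∷ e₃ Vec.∷ e₄ Vec.∷ Vec.[]) in
      (∀ c → ¬ c ~ E c) → ∃₂ λ i j → E i ~ E j
    non-neighbour-choices = from-yes (all? λ e₀ → all? λ e₁ → all? λ e₂ → all? λ e₃ → all? λ e₄ →
      let E = Vec.lookup (e₀ Vec.∷ e₁ Vec.∷ e₂ Vec.∷ e₃ Vec.∷ e₄ Vec.∷ Vec.[]) in
      all? (λ c → ¬? (c ~? E c)) →-dec any? λ i → any? λ j → E i ~? E j)

  non-neighbour-choice-has-edge : (E : Fin 5 → Fin 5) → (∀ c → ¬ c ~ E c) → ∃₂ λ i j → E i ~ E j
  non-neighbour-choice-has-edge E ¬c~E
    with non-neighbour-choices (E 0F) (E 1F) (E 2F) (E 3F) (E 4F)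
           (λ c → subst (λ e → ¬ c ~ e) (sym (Vec.lookup∘tabulate E c)) (¬c~E c))
  ... | i , j , Ei~Ej = i , j , subst₂ _~_ (Vec.lookup∘tabulate E i) (Vec.lookup∘tabulate E j) Ei~Ej

  -- Five-cycles through a vertex

  module FiveCycles {n} (G : Graph n) where

    record Cycle (x₀ x₁ x₂ x₃ x₄ : Fin n) : Set where
      field
        adj₀₁ : adj G x₀ x₁ ≡ true
        adj₁₂ : adj G x₁ x₂ ≡ true
        adj₂₃ : adj G x₂ x₃ ≡ true
        adj₃₄ : adj G x₃ x₄ ≡ true
        adj₄₀ : adj G x₄ x₀ ≡ true
        x₀≢x₁ : x₀ ≢ x₁
        x₀≢x₂ : x₀ ≢ x₂
        x₀≢x₃ : x₀ ≢ x₃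
        x₀≢x₄ : x₀ ≢ x₄
        x₁≢x₂ : x₁ ≢ x₂
        x₁≢x₃ : x₁ ≢ x₃
        x₁≢x₄ : x₁ ≢ x₄
        x₂≢x₃ : x₂ ≢ x₃
        x₂≢x₄ : x₂ ≢ x₄
        x₃≢x₄ : x₃ ≢ x₄

    rotate : ∀ {x₀ x₁ x₂ x₃ x₄} → Cycle x₀ x₁ x₂ x₃ x₄ → Cycle x₁ x₂ x₃ x₄ x₀
    rotate C = record
      { adj₀₁ = adj₁₂ ; adj₁₂ = adj₂₃ ; adj₂₃ = adj₃₄ ; adj₃₄ = adj₄₀ ; adj₄₀ = adj₀₁
      ; x₀≢x₁ = x₁≢x₂ ; x₀≢x₂ = x₁≢x₃ ; x₀≢x₃ = x₁≢x₄ ; x₀≢x₄ = ≢-sym x₀≢x₁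
      ; x₁≢x₂ = x₂≢x₃ ; x₁≢x₃ = x₂≢x₄ ; x₁≢x₄ = ≢-sym x₀≢x₂
      ; x₂≢x₃ = x₃≢x₄ ; x₂≢x₄ = ≢-sym x₀≢x₃
      ; x₃≢x₄ = ≢-sym x₀≢x₄ }
      where open Cycle C

    -- The conjuncts of goodC5 verbatim, so that does (through? …) is goodC5 itself.
    Through : Fin n → (x₀ x₁ x₂ x₃ x₄ : Fin n) → Set
    Through w x₀ x₁ x₂ x₃ x₄ =
      (adj G x₀ x₁ ≡ true × adj G x₁ x₂ ≡ true × adj G x₂ x₃ ≡ true ×
       adj G x₃ x₄ ≡ true × adj G x₄ x₀ ≡ true) ×
      (≢ᵇ x₀ x₁ × ≢ᵇ x₀ x₂ × ≢ᵇ x₀ x₃ × ≢ᵇ x₀ x₄ × ≢ᵇ x₁ x₂ ×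
       ≢ᵇ x₁ x₃ × ≢ᵇ x₁ x₄ × ≢ᵇ x₂ x₃ × ≢ᵇ x₂ x₄ × ≢ᵇ x₃ x₄) ×
      (≡ᵇ w x₀ ⊎ ≡ᵇ w x₁ ⊎ ≡ᵇ w x₂ ⊎ ≡ᵇ w x₃ ⊎ ≡ᵇ w x₄)
      where
      ≡ᵇ ≢ᵇ : Fin n → Fin n → Set
      ≡ᵇ a b = ⌊ a ≟ b ⌋ ≡ true
      ≢ᵇ a b = not ⌊ a ≟ b ⌋ ≡ true

    through? : ∀ w x₀ x₁ x₂ x₃ x₄ → Dec (Through w x₀ x₁ x₂ x₃ x₄)
    through? w x₀ x₁ x₂ x₃ x₄ =
      (adj? x₀ x₁ ×-dec adj? x₁ x₂ ×-dec adj? x₂ x₃ ×-dec adj? x₃ x₄ ×-dec adj? x₄ x₀) ×-dec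
      (≢? x₀ x₁ ×-dec ≢? x₀ x₂ ×-dec ≢? x₀ x₃ ×-dec ≢? x₀ x₄ ×-dec ≢? x₁ x₂ ×-dec
       ≢? x₁ x₃ ×-dec ≢? x₁ x₄ ×-dec ≢? x₂ x₃ ×-dec ≢? x₂ x₄ ×-dec ≢? x₃ x₄) ×-dec
      (≡? w x₀ ⊎-dec ≡? w x₁ ⊎-dec ≡? w x₂ ⊎-dec ≡? w x₃ ⊎-dec ≡? w x₄)
      where
      adj? ≡? ≢? : ∀ a b → Dec _
      adj? a b = isTrue? (adj G a b)
      ≡? a b = isTrue? ⌊ a ≟ b ⌋
      ≢? a b = isTrue? (not ⌊ a ≟ b ⌋)

    dC5≡∑⁵ : ∀ w → dC5 G w ≡ ∑⁵ λ x₀ x₁ x₂ x₃ x₄ → 𝟙 (through? w x₀ x₁ x₂ x₃ x₄)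
    dC5≡∑⁵ w = ∑-allFin {n} λ x₀ → ∑-allFin {n} λ x₁ → ∑-allFin {n} λ x₂ →
               ∑-allFin {n} λ x₃ → ∑-allFin {n} λ x₄ → refl

    through⇒cycle : ∀ {w x₀ x₁ x₂ x₃ x₄} → Through w x₀ x₁ x₂ x₃ x₄ →
                    Cycle x₀ x₁ x₂ x₃ x₄ × (w ≡ x₀ ⊎ w ≡ x₁ ⊎ w ≡ x₂ ⊎ w ≡ x₃ ⊎ w ≡ x₄)
    through⇒cycle ((a₀₁ , a₁₂ , a₂₃ , a₃₄ , a₄₀) ,
                   (d₀₁ , d₀₂ , d₀₃ , d₀₄ , d₁₂ , d₁₃ , d₁₄ , d₂₃ , d₂₄ , d₃₄) , w∈) =
      record
        { adj₀₁ = a₀₁ ; adj₁₂ = a₁₂ ; adj₂₃ = a₂₃ ; adj₃₄ = a₃₄ ; adj₄₀ = a₄₀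
        ; x₀≢x₁ = distinct d₀₁ ; x₀≢x₂ = distinct d₀₂ ; x₀≢x₃ = distinct d₀₃ ; x₀≢x₄ = distinct d₀₄
        ; x₁≢x₂ = distinct d₁₂ ; x₁≢x₃ = distinct d₁₃ ; x₁≢x₄ = distinct d₁₄
        ; x₂≢x₃ = distinct d₂₃ ; x₂≢x₄ = distinct d₂₄ ; x₃≢x₄ = distinct d₃₄ }
      , Sum.map same (Sum.map same (Sum.map same (Sum.map same same))) w∈
      where
      same : ∀ {a b : Fin n} → ⌊ a ≟ b ⌋ ≡ true → a ≡ b
      same e = toWitness (Equivalence.from T-≡ e)
      distinct : ∀ {a b : Fin n} → not ⌊ a ≟ b ⌋ ≡ true → a ≢ b
      distinct e = toWitnessFalse (Equivalence.from T-≡ e)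

    -- w sits at one of the five positions of each map counted by dC5; rotating the
    -- map brings w to the front, and rotation does not change the sum.
    dC5-≤-rooted : ∀ w (Ψ : Fin n → Fin n → Fin n → Fin n → ℕ) →
                   (∀ {y₁ y₂ y₃ y₄} → Cycle w y₁ y₂ y₃ y₄ → 0 < Ψ y₁ y₂ y₃ y₄) → dC5 G w ≤ 5 * ∑⁴ Ψ
    dC5-≤-rooted w Ψ Ψ-positive = begin
      dC5 G w
        ≡⟨ dC5≡∑⁵ w ⟩
      ∑⁵ (λ x₀ x₁ x₂ x₃ x₄ → 𝟙 (through? w x₀ x₁ x₂ x₃ x₄))
        ≤⟨ ∑-mono-≤ (λ x₀ → ∑-mono-≤ λ x₁ → ∑-mono-≤ λ x₂ → ∑-mono-≤ λ x₃ → ∑-mono-≤ λ x₄ →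
                       𝟙-≤ (through? w x₀ x₁ x₂ x₃ x₄) (rooted-somewhere ∘ through⇒cycle)) ⟩
      ∑⁵ rotations
        ≡⟨ trans (∑⁵-+ F _) (cong (∑⁵ F +_) (trans (∑⁵-+ F₁ _) (cong (∑⁵ F₁ +_)
             (trans (∑⁵-+ F₂ _) (cong (∑⁵ F₂ +_) (∑⁵-+ F₃ F₄)))))) ⟩
      ∑⁵ F + (∑⁵ F₁ + (∑⁵ F₂ + (∑⁵ F₃ + ∑⁵ F₄)))
        ≡⟨ cong₂ (λ x y → ∑⁵ F + (x + y)) ∑F₁ (cong₂ _+_ ∑F₂ (cong₂ _+_ ∑F₃ ∑F₄)) ⟩
      ∑⁵ F + (∑⁵ F + (∑⁵ F + (∑⁵ F + ∑⁵ F)))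
        ≡⟨ cong (λ x → ∑⁵ F + (∑⁵ F + (∑⁵ F + (∑⁵ F + x)))) (+-identityʳ (∑⁵ F)) ⟨
      5 * ∑⁵ F
        ≡⟨ cong (5 *_) ∑F ⟩
      5 * ∑⁴ Ψ
        ∎
      where
      open ≤-Reasoning
      F F₁ F₂ F₃ F₄ : Fin n → Fin n → Fin n → Fin n → Fin n → ℕ
      F x₀ x₁ x₂ x₃ x₄ = 𝟙 (x₀ ≟ w) * Ψ x₁ x₂ x₃ x₄
      F₁ = rotate⁵ F
      F₂ = rotate⁵ F₁
      F₃ = rotate⁵ F₂
      F₄ = rotate⁵ F₃

      rotations : Fin n → Fin n → Fin n → Fin n → Fin n → ℕ
      rotations a b c d e = F a b c d e + (F₁ a b c d e + (F₂ a b c d e + (F₃ a b c d e + F₄ a b c d e)))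

      ∑F₁ : ∑⁵ F₁ ≡ ∑⁵ F
      ∑F₁ = ∑⁵-rotate F
      ∑F₂ : ∑⁵ F₂ ≡ ∑⁵ F
      ∑F₂ = trans (∑⁵-rotate F₁) ∑F₁
      ∑F₃ : ∑⁵ F₃ ≡ ∑⁵ F
      ∑F₃ = trans (∑⁵-rotate F₂) ∑F₂
      ∑F₄ : ∑⁵ F₄ ≡ ∑⁵ F
      ∑F₄ = trans (∑⁵-rotate F₃) ∑F₃

      ∑F : ∑⁵ F ≡ ∑⁴ Ψ
      ∑F = begin-equality
        ∑⁵ F                           ≡⟨ sum-cong-≗ (λ a → ∑⁴-*ˡ (𝟙 (a ≟ w)) Ψ) ⟩
        ∑[ a < n ] (𝟙 (a ≟ w) * ∑⁴ Ψ)  ≡⟨ ∑-*ʳ (∑⁴ Ψ) (λ a → 𝟙 (a ≟ w)) ⟩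
        count (_≟ w) * ∑⁴ Ψ            ≡⟨ cong (_* ∑⁴ Ψ) (count-≟ w) ⟩
        1 * ∑⁴ Ψ                       ≡⟨ *-identityˡ (∑⁴ Ψ) ⟩
        ∑⁴ Ψ                           ∎

      rooted : ∀ {x₀ x₁ x₂ x₃ x₄} → Cycle x₀ x₁ x₂ x₃ x₄ → w ≡ x₀ → 0 < F x₀ x₁ x₂ x₃ x₄
      rooted C refl = *-mono-≤ (𝟙-positive (w ≟ w) refl) (Ψ-positive C)

      rooted-somewhere : ∀ {x₀ x₁ x₂ x₃ x₄} → Cycle x₀ x₁ x₂ x₃ x₄ × (w ≡ x₀ ⊎ w ≡ x₁ ⊎ w ≡ x₂ ⊎ w ≡ x₃ ⊎ w ≡ x₄) →
                         0 < rotations x₀ x₁ x₂ x₃ x₄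
      rooted-somewhere (C , w∈C) =
        +-positive (Sum.map (rooted C) (+-positive ∘ Sum.map (rooted (rotate C)) (+-positive ∘ Sum.map (rooted (rotate² C))
          (+-positive ∘ Sum.map (rooted (rotate (rotate² C))) (rooted (rotate² (rotate² C)))))) w∈C)
        where
        rotate² : ∀ {x₀ x₁ x₂ x₃ x₄} → Cycle x₀ x₁ x₂ x₃ x₄ → Cycle x₂ x₃ x₄ x₀ x₁
        rotate² = rotate ∘ rotate

  -- A C₅-colouring of G − v

  module Colouring {n} (G : Graph n) (v : Fin n) (col : Fin n → Fin 5)
                   (col-hom : ∀ {a b} → a ≢ v → b ≢ v → adj G a b ≡ true → col a ~ col b) where

    open FiveCycles G

    infix 4 _∈X_ _∈X?_

    _∈X_ : Fin n → Fin 5 → Set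
    z ∈X k = z ≢ v × col z ≡ k

    _∈X?_ : ∀ z k → Dec (z ∈X k)
    z ∈X? k = ¬? (z ≟ v) ×-dec col z ≟ k

    X : Fin 5 → Fin n → ℕ
    X k z = 𝟙 (z ∈X? k)

    ∣X_∣ : Fin 5 → ℕ
    ∣X k ∣ = count (_∈X? k)

    ∣X∣³ : Fin 5 → ℕ
    ∣X∣³ c = ∣X next (next c) ∣ * ∣X prev (prev c) ∣ * ∣X prev c ∣

    Nbr⁺ NonNbr⁺ : Fin n → Fin n → Set
    Nbr⁺ w z = adj G w z ≡ true × z ∈X next (col w)
    NonNbr⁺ w z = ¬ adj G w z ≡ true × z ∈X next (col w)

    nbr⁺? : ∀ w z → Dec (Nbr⁺ w z)
    nbr⁺? w z = isTrue? (adj G w z) ×-dec z ∈X? next (col w)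

    nonNbr⁺? : ∀ w z → Dec (NonNbr⁺ w z)
    nonNbr⁺? w z = ¬? (isTrue? (adj G w z)) ×-dec z ∈X? next (col w)

    N⁺ T⁺ : Fin n → ℕ
    N⁺ w = count (nbr⁺? w)
    T⁺ w = count (nonNbr⁺? w)

    N⁺+T⁺ : ∀ w → N⁺ w + T⁺ w ≡ ∣X next (col w) ∣
    N⁺+T⁺ w = count-split (_∈X? next (col w)) (λ z → isTrue? (adj G w z))

    classes≤n : ∀ c → ∣X c ∣ + (∣X next c ∣ + ∣X next (next c) ∣ + ∣X prev (prev c) ∣ + ∣X prev c ∣) ≤ n
    classes≤n c = begin
      ∣X c ∣ + (∣X next c ∣ + ∣X next (next c) ∣ + ∣X prev (prev c) ∣ + ∣X prev c ∣)
        ≡⟨ sym (trans (∑-distrib-+ (X c) _) (cong (∣X c ∣ +_) (trans (∑-distrib-+ _ (X (prev c)))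
             (cong (_+ ∣X prev c ∣) (trans (∑-distrib-+ _ (X (prev (prev c))))
             (cong (_+ ∣X prev (prev c) ∣) (∑-distrib-+ (X (next c)) (X (next (next c)))))))))) ⟩
      ∑[ z < n ] (X c z + (X (next c) z + X (next (next c)) z + X (prev (prev c)) z + X (prev c) z))
        ≤⟨ ∑-mono-≤ (λ z → ≤-trans
             (+-mono-≤ (in-class z) (+-mono-≤ (+-mono-≤ (+-mono-≤ (in-class z) (in-class z)) (in-class z)) (in-class z)))
             (five-colours (col z) c)) ⟩
      ∑[ z < n ] 1
        ≡⟨ ∑-one n ⟩
      n ∎
      where
      open ≤-Reasoning
      in-class : ∀ z {k} → X k z ≤ 𝟙 (col z ≟ k)
      in-class z {k} = 𝟙-≤ (z ∈X? k) (𝟙-positive (col z ≟ k) ∘ proj₂)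

    -- A 5-cycle through w that avoids v is coloured by a closed 5-walk of C₅, which goes
    -- once around C₅ in one direction or the other; at most 4 n³ of the cycles meet v.
    dC5-≤-off-v : ∀ {w} → w ≢ v → dC5 G w ≤ 10 * (N⁺ w * ∣X∣³ (col w)) + 20 * (n * n * n)
    dC5-≤-off-v {w} w≢v = begin
      dC5 G w   ≤⟨ dC5-≤-rooted w Ψ Ψ-positive ⟩
      5 * ∑⁴ Ψ  ≡⟨ cong (5 *_) ∑⁴Ψ ⟩
      5 * (N⁺ w * X₂ * X₃ * X₄ + (X₄ * X₃ * X₂ * N⁺ w + 4 * (n * n * n)))
                ≡⟨ collect (N⁺ w) X₂ X₃ X₄ n ⟩
      10 * (N⁺ w * ∣X∣³ (col w)) + 20 * (n * n * n) ∎
      where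
      open ≤-Reasoning
      c : Fin 5
      c = col w
      X₂ X₃ X₄ : ℕ
      X₂ = ∣X next (next c) ∣
      X₃ = ∣X prev (prev c) ∣
      X₄ = ∣X prev c ∣

      nbr δ 𝟏 : Fin n → ℕ
      nbr z = 𝟙 (nbr⁺? w z)
      δ z = 𝟙 (z ≟ v)
      𝟏 _ = 1

      clockwise-paths anticlockwise-paths through-v Ψ : Fin n → Fin n → Fin n → Fin n → ℕ
      clockwise-paths = nbr ⊗ X (next (next c)) ⊗ X (prev (prev c)) ⊗ X (prev c)
      anticlockwise-paths = X (prev c) ⊗ X (prev (prev c)) ⊗ X (next (next c)) ⊗ nbr
      through-v = (δ ⊗ 𝟏 ⊗ 𝟏 ⊗ 𝟏) ⊕ (𝟏 ⊗ δ ⊗ 𝟏 ⊗ 𝟏)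
                ⊕ (𝟏 ⊗ 𝟏 ⊗ δ ⊗ 𝟏) ⊕ (𝟏 ⊗ 𝟏 ⊗ 𝟏 ⊗ δ)
      Ψ = clockwise-paths ⊕ anticlockwise-paths ⊕ through-v

      X-positive : ∀ {z k} → z ∈X k → 0 < X k z
      X-positive {z} {k} = 𝟙-positive (z ∈X? k)

      nbr-positive : ∀ {z} → adj G w z ≡ true → z ∈X next c → 0 < nbr z
      nbr-positive {z} w~z z∈X = 𝟙-positive (nbr⁺? w z) (w~z , z∈X)

      δ-positive : ∀ {z} → z ≡ v → 0 < δ z
      δ-positive {z} = 𝟙-positive (z ≟ v)

      Ψ-positive : ∀ {y₁ y₂ y₃ y₄} → Cycle w y₁ y₂ y₃ y₄ → 0 < Ψ y₁ y₂ y₃ y₄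
      Ψ-positive {y₁} {y₂} {y₃} {y₄} C with y₁ ≟ v ⊎-dec y₂ ≟ v ⊎-dec y₃ ≟ v ⊎-dec y₄ ≟ v
      ... | yes v∈C =
            +-positive {clockwise-paths y₁ y₂ y₃ y₄}
              (inj₂ (+-positive {anticlockwise-paths y₁ y₂ y₃ y₄} (inj₂ (v-positive v∈C))))
        where
        v-positive : y₁ ≡ v ⊎ y₂ ≡ v ⊎ y₃ ≡ v ⊎ y₄ ≡ v → 0 < through-v y₁ y₂ y₃ y₄
        v-positive = +-positive ∘ Sum.map
          (λ e → *-positive⁴ (δ-positive e) ≤-refl ≤-refl ≤-refl) (+-positive ∘ Sum.map
          (λ e → *-positive⁴ ≤-refl (δ-positive e) ≤-refl ≤-refl) (+-positive ∘ Sum.map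
          (λ e → *-positive⁴ ≤-refl ≤-refl (δ-positive e) ≤-refl)
          (λ e → *-positive⁴ ≤-refl ≤-refl ≤-refl (δ-positive e))))
      ... | no v∉C =
            +-positive (Sum.map₂ (+-positive {b = through-v y₁ y₂ y₃ y₄} ∘ inj₁) (Sum.map clockwise anticlockwise
              (closed-5-walk (col-hom w≢v y₁≢v adj₀₁) (col-hom y₁≢v y₂≢v adj₁₂) (col-hom y₂≢v y₃≢v adj₂₃)
                             (col-hom y₃≢v y₄≢v adj₃₄) (col-hom y₄≢v w≢v adj₄₀))))
        where
        open Cycle C
        y₁≢v : y₁ ≢ v
        y₁≢v = v∉C ∘ inj₁
        y₂≢v : y₂ ≢ v
        y₂≢v = v∉C ∘ inj₂ ∘ inj₁
        y₃≢v : y₃ ≢ v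
        y₃≢v = v∉C ∘ inj₂ ∘ inj₂ ∘ inj₁
        y₄≢v : y₄ ≢ v
        y₄≢v = v∉C ∘ inj₂ ∘ inj₂ ∘ inj₂
        clockwise : col y₁ ≡ next c × col y₂ ≡ next (next c) × col y₃ ≡ prev (prev c) × col y₄ ≡ prev c →
                    0 < clockwise-paths y₁ y₂ y₃ y₄
        clockwise (e₁ , e₂ , e₃ , e₄) =
          *-positive⁴ (nbr-positive adj₀₁ (y₁≢v , e₁)) (X-positive (y₂≢v , e₂))
                      (X-positive (y₃≢v , e₃)) (X-positive (y₄≢v , e₄))
        anticlockwise : col y₁ ≡ prev c × col y₂ ≡ prev (prev c) × col y₃ ≡ next (next c) × col y₄ ≡ next c →
                        0 < anticlockwise-paths y₁ y₂ y₃ y₄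
        anticlockwise (e₁ , e₂ , e₃ , e₄) =
          *-positive⁴ (X-positive (y₁≢v , e₁)) (X-positive (y₂≢v , e₂)) (X-positive (y₃≢v , e₃))
                      (nbr-positive (trans (Graph.sym G w y₄) adj₄₀) (y₄≢v , e₄))

      ∑⁴-through-v : ∑⁴ through-v ≡ 4 * (n * n * n)
      ∑⁴-through-v = begin-equality
        ∑⁴ through-v
          ≡⟨ trans (∑⁴-+ (δ ⊗ 𝟏 ⊗ 𝟏 ⊗ 𝟏) _) (cong₂ _+_ (∑⁴-⊗ δ 𝟏 𝟏 𝟏)
             (trans (∑⁴-+ (𝟏 ⊗ δ ⊗ 𝟏 ⊗ 𝟏) _) (cong₂ _+_ (∑⁴-⊗ 𝟏 δ 𝟏 𝟏)
             (trans (∑⁴-+ (𝟏 ⊗ 𝟏 ⊗ δ ⊗ 𝟏) _)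
                    (cong₂ _+_ (∑⁴-⊗ 𝟏 𝟏 δ 𝟏) (∑⁴-⊗ 𝟏 𝟏 𝟏 δ)))))) ⟩
        d * o * o * o + (o * d * o * o + (o * o * d * o + o * o * o * d))
          ≡⟨ cong₂ (λ d o → d * o * o * o + (o * d * o * o + (o * o * d * o + o * o * o * d))) (count-≟ v) (∑-one n) ⟩
        1 * n * n * n + (n * 1 * n * n + (n * n * 1 * n + n * n * n * 1))
          ≡⟨ four-cubes n ⟩
        4 * (n * n * n) ∎
        where
        d o : ℕ
        d = sum δ
        o = sum 𝟏
        four-cubes : ∀ n → 1 * n * n * n + (n * 1 * n * n + (n * n * 1 * n + n * n * n * 1)) ≡ 4 * (n * n * n)
        four-cubes = solve-∀

      ∑⁴Ψ : ∑⁴ Ψ ≡ N⁺ w * X₂ * X₃ * X₄ + (X₄ * X₃ * X₂ * N⁺ w + 4 * (n * n * n))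
      ∑⁴Ψ = trans (∑⁴-+ clockwise-paths _) (cong₂ _+_ (∑⁴-⊗ nbr _ _ _)
              (trans (∑⁴-+ anticlockwise-paths through-v) (cong₂ _+_ (∑⁴-⊗ _ _ _ nbr) ∑⁴-through-v)))

      collect : ∀ N a b d n → 5 * (N * a * b * d + (d * b * a * N + 4 * (n * n * n))) ≡ 10 * (N * (a * b * d)) + 20 * (n * n * n)
      collect = solve-∀

    module Dense (M L : ℕ) .{{_ : NonZero L}}
                 (dense : ∀ u → suc M * (n * n * n * n) ≤ L * dC5 G u) (20L≤n : 20 * L ≤ n) where

      0<n : 0 < n
      0<n = <-≤-trans (*-monoʳ-< 20 (>-nonZero⁻¹ L)) 20L≤n

      N⁺∣X∣³-large : ∀ {w} → w ≢ v → M * (n * n * n * n) ≤ 10 * L * (N⁺ w * ∣X∣³ (col w))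
      N⁺∣X∣³-large {w} w≢v =
        absorb-cubic {M} {L} {dC5 G w} {N⁺ w * ∣X∣³ (col w)} {n} (dense w) (dC5-≤-off-v w≢v) 20L≤n

      module _ (p q r : ℕ) (q≡r+p : q ≡ r + p) (p-small : 10 * L * (p * p * p * p) ≤ 256 * M * (q * q * q * q)) where

        -- By AM–GM the four classes other than X c, whose product is at least
        -- M n⁴ / (10 L), have at least (p / q) n vertices in total.
        ∣X∣-small-at : ∀ {z} → z ≢ v → ∣X col z ∣ * q ≤ r * n
        ∣X∣-small-at {z} z≢v = complement-≤ {∣X c ∣} {s} {n} {p} {q} {r} (classes≤n c)
          (⁴-ratio-≤ {10 * L} {256 * M} {p} {q} {n} {s} {{m*n≢0 10 L}} p-small 256Mn⁴≤10Ls⁴) q≡r+p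
          where
          open ≤-Reasoning
          c : Fin 5
          c = col z
          A₁ A₂ A₃ A₄ s : ℕ
          A₁ = ∣X next c ∣
          A₂ = ∣X next (next c) ∣
          A₃ = ∣X prev (prev c) ∣
          A₄ = ∣X prev c ∣
          s = A₁ + A₂ + A₃ + A₄
          N⁺≤A₁ : N⁺ z ≤ A₁
          N⁺≤A₁ = ≤-trans (m≤m+n (N⁺ z) (T⁺ z)) (≤-reflexive (N⁺+T⁺ z))
          256Mn⁴≤10Ls⁴ : 256 * M * (n * n * n * n) ≤ 10 * L * (s * s * s * s)
          256Mn⁴≤10Ls⁴ = begin
            256 * M * (n * n * n * n)            ≡⟨ *-assoc 256 M _ ⟩
            256 * (M * (n * n * n * n))          ≤⟨ *-monoʳ-≤ 256 (N⁺∣X∣³-large z≢v) ⟩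
            256 * (10 * L * (N⁺ z * ∣X∣³ c))
              ≤⟨ *-monoʳ-≤ 256 (*-monoʳ-≤ (10 * L) (*-monoˡ-≤ (∣X∣³ c) N⁺≤A₁)) ⟩
            256 * (10 * L * (A₁ * ∣X∣³ c))       ≡⟨ shuffle (10 * L) A₁ A₂ A₃ A₄ ⟩
            10 * L * (256 * (A₁ * A₂ * A₃ * A₄)) ≤⟨ *-monoʳ-≤ (10 * L) (am-gm⁴ A₁ A₂ A₃ A₄) ⟩
            10 * L * (s * s * s * s)             ∎
            where
            shuffle : ∀ B a b c d → 256 * (B * (a * (b * c * d))) ≡ B * (256 * (a * b * c * d))
            shuffle = solve-∀

        ∣X∣-small : ∀ k → ∣X k ∣ * q ≤ r * n
        ∣X∣-small k with ∣X k ∣ in eq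
        ... | zero  = z≤n
        ... | suc _ with count-positive (_∈X? k) (subst (0 <_) (sym eq) z<s)
        ...   | z , z≢v , refl = subst (λ a → a * q ≤ r * n) eq (∣X∣-small-at z≢v)

        module _ (γ : ℕ) (γ-large : 10 * L * (r * r * r * r) ≤ γ + M * (q * q * q * q)) where

          T⁺-small : ∀ {w} → w ≢ v → T⁺ w * (M * (q * q * q * q)) ≤ γ * n
          T⁺-small {w} w≢v = excess-≤ {M} {10 * L} {N⁺ w} {T⁺ w} {A₁} {∣X∣³ c} {q} {r} {γ} {n}
                               0<n (N⁺∣X∣³-large w≢v) (N⁺+T⁺ w) (count≤n (nbr⁺? w)) q⁴A₁Q≤r⁴n⁴ γ-large
            where
            open ≤-Reasoning
            c : Fin 5
            c = col w
            A₁ A₂ A₃ A₄ : ℕ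
            A₁ = ∣X next c ∣
            A₂ = ∣X next (next c) ∣
            A₃ = ∣X prev (prev c) ∣
            A₄ = ∣X prev c ∣
            q⁴A₁Q≤r⁴n⁴ : (q * q * q * q) * (A₁ * ∣X∣³ c) ≤ (r * r * r * r) * (n * n * n * n)
            q⁴A₁Q≤r⁴n⁴ = begin
              (q * q * q * q) * (A₁ * (A₂ * A₃ * A₄))   ≡⟨ spread q A₁ A₂ A₃ A₄ ⟩
              (A₁ * q) * (A₂ * q) * (A₃ * q) * (A₄ * q)
                ≤⟨ *-mono-≤ (*-mono-≤ (*-mono-≤ (∣X∣-small _) (∣X∣-small _)) (∣X∣-small _)) (∣X∣-small _) ⟩
              (r * n) * (r * n) * (r * n) * (r * n)     ≡⟨ solve (r ∷ n ∷ []) ⟩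
              (r * r * r * r) * (n * n * n * n)         ∎
              where
              spread : ∀ q a b c d → (q * q * q * q) * (a * (b * c * d)) ≡ (a * q) * (b * q) * (c * q) * (d * q)
              spread = solve-∀

  -- The deleted vertex

  module DeletedVertex {n} (G : Graph n) (triangle-free : TriangleFree G) (v : Fin n) (col : Fin n → Fin 5)
                       (col-hom : ∀ {a b} → a ≢ v → b ≢ v → adj G a b ≡ true → col a ~ col b) where

    open FiveCycles G
    open Colouring G v col col-hom

    reflect-col-hom : ∀ {a b} → a ≢ v → b ≢ v → adj G a b ≡ true → reflect (col a) ~ reflect (col b)
    reflect-col-hom a≢v b≢v a~b = reflect-hom (col-hom a≢v b≢v a~b)

    module Reflected = Colouring G v (reflect ∘ col) reflect-col-hom

    neighbour≢v : ∀ {z} → adj G v z ≡ true → z ≢ v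
    neighbour≢v {z} v~z refl = contradiction (trans (sym v~z) (Graph.loopless G z)) λ ()

    neighbours-non-adjacent : ∀ {w z} → adj G v w ≡ true → adj G v z ≡ true → ¬ adj G w z ≡ true
    neighbours-non-adjacent {w} {z} v~w v~z w~z = triangle-free v w z v~w w~z v~z

    module _ {x y} (v~x : adj G v x ≡ true) (v~y : adj G v y ≡ true) (x~y : col x ~ col y) where

      S : Fin n → Set
      S z = adj G v z ≡ true × (col x ~ col z ⊎ col y ~ col z)

      S? : ∀ z → Dec (S z)
      S? z = isTrue? (adj G v z) ×-dec (col x ~? col z ⊎-dec col y ~? col z)

      -- In a 5-cycle v y₁ y₂ y₃ y₄ with y₁, y₄ ∉ S, both y₁ and y₄ would get the only
      -- colour adjacent to neither col x nor col y, closing a walk of length 3 in C₅.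
      dC5-v-≤ : dC5 G v ≤ 10 * (count S? * (n * n * n))
      dC5-v-≤ = begin
        dC5 G v   ≤⟨ dC5-≤-rooted v Ψ Ψ-positive ⟩
        5 * ∑⁴ Ψ  ≡⟨ cong (5 *_) (trans (∑⁴-+ (s ⊗ 𝟏 ⊗ 𝟏 ⊗ 𝟏) (𝟏 ⊗ 𝟏 ⊗ 𝟏 ⊗ s))
                                        (cong₂ _+_ (∑⁴-⊗ s 𝟏 𝟏 𝟏) (∑⁴-⊗ 𝟏 𝟏 𝟏 s))) ⟩
        5 * (count S? * sum 𝟏 * sum 𝟏 * sum 𝟏 + sum 𝟏 * sum 𝟏 * sum 𝟏 * count S?)
                  ≡⟨ cong (λ o → 5 * (count S? * o * o * o + o * o * o * count S?)) (∑-one n) ⟩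
        5 * (count S? * n * n * n + n * n * n * count S?)
                  ≡⟨ collect (count S?) n ⟩
        10 * (count S? * (n * n * n)) ∎
        where
        open ≤-Reasoning
        s 𝟏 : Fin n → ℕ
        s z = 𝟙 (S? z)
        𝟏 _ = 1

        Ψ : Fin n → Fin n → Fin n → Fin n → ℕ
        Ψ = (s ⊗ 𝟏 ⊗ 𝟏 ⊗ 𝟏) ⊕ (𝟏 ⊗ 𝟏 ⊗ 𝟏 ⊗ s)

        Ψ-positive : ∀ {y₁ y₂ y₃ y₄} → Cycle v y₁ y₂ y₃ y₄ → 0 < Ψ y₁ y₂ y₃ y₄
        Ψ-positive {y₁} {y₂} {y₃} {y₄} C with S? y₁ | S? y₄
        ... | yes y₁∈S | _ = +-positive (inj₁ (*-positive⁴ (𝟙-positive (S? y₁) y₁∈S) ≤-refl ≤-refl ≤-refl))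
        ... | no _ | yes y₄∈S =
              +-positive {(s ⊗ 𝟏 ⊗ 𝟏 ⊗ 𝟏) y₁ y₂ y₃ y₄}
                (inj₂ (*-positive⁴ ≤-refl ≤-refl ≤-refl (𝟙-positive (S? y₄) y₄∈S)))
        ... | no y₁∉S | no y₄∉S = contradiction
              (common-non-neighbour-unique x~y (y₁∉S ∘ (adj₀₁ ,_) ∘ inj₁) (y₁∉S ∘ (adj₀₁ ,_) ∘ inj₂)
                                               (y₄∉S ∘ (v~y₄ ,_) ∘ inj₁) (y₄∉S ∘ (v~y₄ ,_) ∘ inj₂))
              (no-closed-3-walk (col-hom y₁≢v y₂≢v adj₁₂) (col-hom y₂≢v y₃≢v adj₂₃)
                                (col-hom y₃≢v y₄≢v adj₃₄))
          where
          open Cycle C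
          v~y₄ : adj G v y₄ ≡ true
          v~y₄ = trans (Graph.sym G v y₄) adj₄₀
          y₁≢v : y₁ ≢ v
          y₁≢v = ≢-sym x₀≢x₁
          y₂≢v : y₂ ≢ v
          y₂≢v = ≢-sym x₀≢x₂
          y₃≢v : y₃ ≢ v
          y₃≢v = ≢-sym x₀≢x₃
          y₄≢v : y₄ ≢ v
          y₄≢v = ≢-sym x₀≢x₄

        collect : ∀ S n → 5 * (S * n * n * n + n * n * n * S) ≡ 10 * (S * (n * n * n))
        collect = solve-∀

      -- A vertex of S is a common neighbour of v and x (or y), hence not adjacent to it,
      -- and its colour follows or precedes that of x (or y); the class preceding a colour
      -- is the class following it in the reflected colouring.
      S-small : count S? ≤ (T⁺ x + Reflected.T⁺ x) + (T⁺ y + Reflected.T⁺ y)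
      S-small = ≤-trans (count-⊆-∪ S? (U? x) (U? y) (Sum.map (in-U v~x) (in-U v~y) ∘ split))
                        (+-mono-≤ (count-⊆-∪ (U? x) (nonNbr⁺? x) (Reflected.nonNbr⁺? x) (λ u → u))
                                  (count-⊆-∪ (U? y) (nonNbr⁺? y) (Reflected.nonNbr⁺? y) (λ u → u)))
        where
        U : Fin n → Fin n → Set
        U w z = NonNbr⁺ w z ⊎ Reflected.NonNbr⁺ w z

        U? : ∀ w z → Dec (U w z)
        U? w z = nonNbr⁺? w z ⊎-dec Reflected.nonNbr⁺? w z

        split : ∀ {z} → S z → (adj G v z ≡ true × col x ~ col z) ⊎ (adj G v z ≡ true × col y ~ col z)
        split (v~z , inj₁ x~z) = inj₁ (v~z , x~z)
        split (v~z , inj₂ y~z) = inj₂ (v~z , y~z)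

        in-U : ∀ {w z} → adj G v w ≡ true → adj G v z ≡ true × col w ~ col z → U w z
        in-U {w} {z} v~w (v~z , w~z) with ~⇒next⊎prev w~z
        ... | inj₁ next = inj₁ (neighbours-non-adjacent v~w v~z , neighbour≢v v~z , next)
        ... | inj₂ prev =
              inj₂ (neighbours-non-adjacent v~w v~z , neighbour≢v v~z , trans (cong reflect prev) (reflect-prev (col w)))

    extend : (c : Fin 5) → (∀ {z} → adj G v z ≡ true → c ~ col z) → C5Colorable G
    extend c c~N = recolour , recolour-hom
      where
      recolour : Fin n → Fin 5
      recolour z = if ⌊ z ≟ v ⌋ then c else col z
      recolour-hom : ∀ a b → adj G a b ≡ true → c5adj (recolour a) (recolour b) ≡ true
      recolour-hom a b a~b with a ≟ v | b ≟ v
      ... | yes refl | yes refl = contradiction (trans (sym a~b) (Graph.loopless G a)) λ ()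
      ... | yes refl | no b≢v   = c~N a~b
      ... | no a≢v   | yes refl = ~-sym (c~N (trans (Graph.sym G b a) a~b))
      ... | no a≢v   | no b≢v   = col-hom a≢v b≢v a~b

    module _ (M L : ℕ) .{{_ : NonZero L}}
             (dense : ∀ u → suc M * (n * n * n * n) ≤ L * dC5 G u) (20L≤n : 20 * L ≤ n)
             (p q r : ℕ) (q≡r+p : q ≡ r + p) (p-small : 10 * L * (p * p * p * p) ≤ 256 * M * (q * q * q * q))
             (γ : ℕ) (γ-large : 10 * L * (r * r * r * r) ≤ γ + M * (q * q * q * q))
             (γ-small : 40 * L * γ < suc M * (M * (q * q * q * q))) where

      neighbour-colours-non-adjacent : ∀ {x y} → adj G v x ≡ true → adj G v y ≡ true → ¬ col x ~ col y
      neighbour-colours-non-adjacent {x} {y} v~x v~y x~y =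
        dense-contradiction {M} {L} {dC5 G v} {count (S? v~x v~y x~y)} {T⁺ x} {Reflected.T⁺ x} {T⁺ y} {Reflected.T⁺ y}
          (Dense.0<n M L dense 20L≤n) (dense v) (dC5-v-≤ v~x v~y x~y) (S-small v~x v~y x~y)
          (T⁺-small (neighbour≢v v~x)) (T⁺-small′ (neighbour≢v v~x))
          (T⁺-small (neighbour≢v v~y)) (T⁺-small′ (neighbour≢v v~y)) γ-small
        where
        T⁺-small : ∀ {w} → w ≢ v → T⁺ w * (M * (q * q * q * q)) ≤ γ * n
        T⁺-small = Dense.T⁺-small M L dense 20L≤n p q r q≡r+p p-small γ γ-large
        T⁺-small′ : ∀ {w} → w ≢ v → Reflected.T⁺ w * (M * (q * q * q * q)) ≤ γ * n
        T⁺-small′ = Reflected.Dense.T⁺-small M L dense 20L≤n p q r q≡r+p p-small γ γ-large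

      colourable : C5Colorable G
      colourable with all? (λ c → any? λ z → isTrue? (adj G v z) ×-dec ¬? (c ~? col z))
      ... | yes witnesses =
        let i , j , Ei~Ej = non-neighbour-choice-has-edge (col ∘ witness) (proj₂ ∘ proj₂ ∘ witnesses)
        in contradiction Ei~Ej (neighbour-colours-non-adjacent (proj₁ (proj₂ (witnesses i))) (proj₁ (proj₂ (witnesses j))))
        where
        witness : Fin 5 → Fin n
        witness c = proj₁ (witnesses c)
      ... | no ¬witnesses =
        let c , ¬witness = ¬∀⟶∃¬ 5 _ (λ c → any? λ z → isTrue? (adj G v z) ×-dec ¬? (c ~? col z)) ¬witnesses
        in extend c λ {z} v~z → decidable-stable (c ~? col z) λ c≁z → ¬witness (z , v~z , c≁z)

  colouring-of-deletion : ∀ {n} (G : Graph n) (v : Fin n) → C5Colorable (deleteVertex G v) →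
    Σ (Fin n → Fin 5) λ col → ∀ {a b} → a ≢ v → b ≢ v → adj G a b ≡ true → col a ~ col b
  colouring-of-deletion {suc m} G v (f , f-hom) = col , col-hom
    where
    col : Fin (suc m) → Fin 5
    col z with v ≟ z
    ... | yes _   = 0F
    ... | no v≢z  = f (punchOut v≢z)

    col-punchOut : ∀ {z} (v≢z : v ≢ z) → col z ≡ f (punchOut v≢z)
    col-punchOut {z} v≢z with v ≟ z
    ... | yes v≡z  = contradiction v≡z v≢z
    ... | no v≢z′  = cong f (punchOut-cong v refl)

    col-hom : ∀ {a b} → a ≢ v → b ≢ v → adj G a b ≡ true → col a ~ col b
    col-hom {a} {b} a≢v b≢v a~b = subst₂ _~_ (sym (col-punchOut (≢-sym a≢v))) (sym (col-punchOut (≢-sym b≢v)))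
      (f-hom _ _ (subst₂ (λ a b → adj G a b ≡ true)
                         (sym (punchIn-punchOut (≢-sym a≢v))) (sym (punchIn-punchOut (≢-sym b≢v))) a~b))

  -- (10 − ε)(n/5)⁴ with ε = 1/10000 is 99999 n⁴ / 6250000, whence M + 1 and L;
  -- p/q = 0.79999 lies just below (256 M / 10 L)^(1/4) ≈ 0.8, and γ = 10 L r⁴ − M q⁴.
  opaque
    M L p q r γ : ℕ
    M = 99998
    L = 6250000
    p = 79999
    q = 100000
    r = 20001
    γ = 2200150005000062500000

    suc-M : suc M ≡ 99999
    suc-M = refl

    L≡ : L ≡ 6250000
    L≡ = refl

    20L≡ : 20 * L ≡ 125000000
    20L≡ = refl

    L≢0 : NonZero L
    L≢0 = _

    q≡r+p : q ≡ r + p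
    q≡r+p = refl

    p-small : 10 * L * (p * p * p * p) ≤ 256 * M * (q * q * q * q)
    p-small = ≤ᵇ⇒≤ _ _ _

    γ-large : 10 * L * (r * r * r * r) ≤ γ + M * (q * q * q * q)
    γ-large = ≤ᵇ⇒≤ _ _ _

    γ-small : 40 * L * γ < suc M * (M * (q * q * q * q))
    γ-small = <ᵇ⇒< _ _ _

  dense-extension : ∀ {n} (G : Graph n) → TriangleFree G →
                    (∀ u → 99999 * (n * n * n * n) ≤ 6250000 * dC5 G u) → 125000000 ≤ n →
                    (v : Fin n) → C5Colorable (deleteVertex G v) → C5Colorable G
  dense-extension {n} G triangle-free dense n-large v G-v-colourable =
    DeletedVertex.colourable G triangle-free v col col-hom M L {{L≢0}} dense′ (subst (_≤ n) (sym 20L≡) n-large)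
      p q r q≡r+p p-small γ γ-large γ-small
    where
    col : Fin n → Fin 5
    col = proj₁ (colouring-of-deletion G v G-v-colourable)
    col-hom : ∀ {a b} → a ≢ v → b ≢ v → adj G a b ≡ true → col a ~ col b
    col-hom = proj₂ (colouring-of-deletion G v G-v-colourable)
    dense′ : ∀ u → suc M * (n * n * n * n) ≤ L * dC5 G u
    dense′ u = subst₂ (λ a b → a * (n * n * n * n) ≤ b * dC5 G u) (sym suc-M) (sym L≡) (dense u)

open import Defs hiding (sym)
open import Data.Nat using (ℕ; _≥_)
open import Data.Fin using (Fin)
open import Data.Integer using (+_)
open import Data.Rational using (ℚ; _/_; _*_; _-_; _≤_; _<_; 0ℚ; toℚᵘ)
open import Data.Product using (Σ; _×_; _,_)

import Data.Nat as ℕ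
import Data.Nat.Properties as ℕ
import Data.Integer as ℤ
import Data.Integer.Properties as ℤ
open import Data.Rational.Properties using (toℚᵘ-mono-≤; toℚᵘ-homo-*; toℚᵘ-fromℚᵘ; positive⁻¹)
open import Data.Rational.Unnormalised as ℚᵘ using (ℚᵘ; mkℚᵘ; *≤*; *≡*; _≃_)
import Data.Rational.Unnormalised.Properties as ℚᵘ
open import Relation.Binary.PropositionalEquality using (_≡_; refl; sym; trans; cong; subst₂)
open C5Extension using (dense-extension)

ε : ℚ
ε = + 1 / 10000

10-ε≃ : toℚᵘ (+ 10 / 1 - ε) ≃ mkℚᵘ (+ 99999) 9999
10-ε≃ = *≡* refl

_⁴ : ℚᵘ → ℚᵘ
x ⁴ = x ℚᵘ.* x ℚᵘ.* x ℚᵘ.* x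

toℚᵘ-⁴ : ∀ x → toℚᵘ (x * x * x * x) ≃ toℚᵘ x ⁴
toℚᵘ-⁴ x = ℚᵘ.≃-trans (toℚᵘ-homo-* (x * x * x) x)
  (ℚᵘ.*-congʳ {toℚᵘ x} (ℚᵘ.≃-trans (toℚᵘ-homo-* (x * x) x) (ℚᵘ.*-congʳ {toℚᵘ x} (toℚᵘ-homo-* x x))))

⁴-cong : ∀ {x y} → x ≃ y → x ⁴ ≃ y ⁴
⁴-cong x≃y = ℚᵘ.*-cong (ℚᵘ.*-cong (ℚᵘ.*-cong x≃y x≃y) x≃y) x≃y

dense-ℚᵘ : ∀ n d → (+ 10 / 1 - ε) * ((+ n / 5) * (+ n / 5) * (+ n / 5) * (+ n / 5)) ≤ + d / 1 →
           mkℚᵘ (+ 99999) 9999 ℚᵘ.* mkℚᵘ (+ n) 4 ⁴ ℚᵘ.≤ mkℚᵘ (+ d) 0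
dense-ℚᵘ n d dense = ℚᵘ.≤-respʳ-≃ (toℚᵘ-fromℚᵘ (mkℚᵘ (+ d) 0)) (ℚᵘ.≤-respˡ-≃ lhs≃ (toℚᵘ-mono-≤ dense))
  where
  n/5 : ℚ
  n/5 = + n / 5
  lhs≃ : toℚᵘ ((+ 10 / 1 - ε) * (n/5 * n/5 * n/5 * n/5)) ≃ mkℚᵘ (+ 99999) 9999 ℚᵘ.* mkℚᵘ (+ n) 4 ⁴
  lhs≃ = ℚᵘ.≃-trans (toℚᵘ-homo-* (+ 10 / 1 - ε) (n/5 * n/5 * n/5 * n/5))
           (ℚᵘ.*-cong {toℚᵘ (+ 10 / 1 - ε)} 10-ε≃ (ℚᵘ.≃-trans (toℚᵘ-⁴ n/5) (⁴-cong (toℚᵘ-fromℚᵘ (mkℚᵘ (+ n) 4)))))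

ℚᵘ-dense-ℕ : ∀ n d → mkℚᵘ (+ 99999) 9999 ℚᵘ.* mkℚᵘ (+ n) 4 ⁴ ℚᵘ.≤ mkℚᵘ (+ d) 0 →
             99999 ℕ.* (n ℕ.* n ℕ.* n ℕ.* n) ℕ.≤ d ℕ.* 6250000
ℚᵘ-dense-ℕ n d (*≤* le) = ℤ.drop‿+≤+ (subst₂ ℤ._≤_ lhs rhs le)
  where
  pos-⁴ : + (n ℕ.* n ℕ.* n ℕ.* n) ≡ + n ℤ.* + n ℤ.* + n ℤ.* + n
  pos-⁴ = trans (ℤ.pos-* (n ℕ.* n ℕ.* n) n) (cong (ℤ._* + n) (trans (ℤ.pos-* (n ℕ.* n) n) (cong (ℤ._* + n) (ℤ.pos-* n n))))
  lhs : + 99999 ℤ.* (+ n ℤ.* + n ℤ.* + n ℤ.* + n) ℤ.* + 1 ≡ + (99999 ℕ.* (n ℕ.* n ℕ.* n ℕ.* n))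
  lhs = trans (ℤ.*-identityʳ _) (trans (cong (+ 99999 ℤ.*_) (sym pos-⁴)) (sym (ℤ.pos-* 99999 (n ℕ.* n ℕ.* n ℕ.* n))))
  rhs : + d ℤ.* + 6250000 ≡ + (d ℕ.* 6250000)
  rhs = sym (ℤ.pos-* d 6250000)

dense-ℕ : ∀ n d → (+ 10 / 1 - ε) * ((+ n / 5) * (+ n / 5) * (+ n / 5) * (+ n / 5)) ≤ + d / 1 →
          99999 ℕ.* (n ℕ.* n ℕ.* n ℕ.* n) ℕ.≤ 6250000 ℕ.* d
dense-ℕ n d dense = ℕ.≤-trans (ℚᵘ-dense-ℕ n d (dense-ℚᵘ n d dense)) (ℕ.≤-reflexive (ℕ.*-comm d 6250000))

proposition5p1 : Σ ℚ λ ε → 0ℚ < ε × Σ ℕ λ N₀ → ∀ (n : ℕ) → n ≥ N₀ → (G : Graph n) → TriangleFree G → (∀ (u : Fin n) → (+ 10 / 1 - ε) * ((+ n / 5) * (+ n / 5) * (+ n / 5) * (+ n / 5)) ≤ (+ dC5 G u / 1)) → (v : Fin n) → C5Colorable (deleteVertex G v) → C5Colorable G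
proposition5p1 = ε , positive⁻¹ ε , 125000000 , λ n n≥N₀ G triangle-free dense →
  dense-extension G triangle-free (λ u → dense-ℕ n (dC5 G u) (dense u)) n≥N₀
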